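{- For all $k_1,k_2,k_1',k_2'\geq 0$, if $k_1+k_2>k_1'+k_2'$, then $\mathsf{C}^{(k_1,k_2)}\not\preceq\mathsf{C}^{(k_1',k_2')}$.
   Context: Colored graphs are finite simple graphs with a vertex coloring. First-order logic with counting $\mathsf{C}$ has atomic formulas $x=y$, $E(x,y)$, $U_c(x)$, Boolean connectives, and quantifiers $\forall,\exists,\exists^{\geq n}$ ($n\in\mathbb{N}$). A variable $x$ is requantified in $\varphi$ if it is both free and bound in $\varphi$, or $\varphi$ has a subformula $Qx\,\psi$ where $\psi$ has a subformula $Q'x\,\chi$ ($Q,Q'$ quantifiers). $\mathsf{C}^{(k_1,k_2)}$ is the set of $\mathsf{C}$-formulas whose variables lie in $\{x_1,\dots,x_{k_1},y_1,\dots,y_{k_2}\}$ and in which no $y_j$ is requantified. A logic $L$ distinguishes two colored graphs if some sentence of $L$ holds in exactly one of them. $L\preceq L'$ means every pair of colored graphs distinguished by $L$ is distinguished by $L'$. -}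

module Defs where

open import Data.Nat using (ℕ; zero; suc; _+_; _<_; _≤_)
open import Data.Nat.Properties using () renaming (_≟_ to _≟ℕ_)
open import Data.Fin using (Fin)
open import Data.Bool using (Bool; true; false)
open import Data.Product using (Σ; _×_; _,_)
open import Data.Sum using (_⊎_)
open import Data.Empty using (⊥)
open import Data.Unit using (⊤)
open import Relation.Nullary using (¬_; Dec; yes; no)
open import Relation.Binary.PropositionalEquality using (_≡_; _≢_; refl; cong)
open import Function.Definitions using (Injective)

record ColoredGraph : Set where
  field
    n        : ℕ
    nonempty : 0 < n
    adj      : Fin n → Fin n → Bool
    adj-sym  : ∀ u v → adj u v ≡ adj v u
    adj-irr  : ∀ v → adj v v ≡ false
    colour   : Fin n → ℕ

open ColoredGraph public

-- Variables: xv i stands for x_{i+1}, yv j stands for y_{j+1}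
-- (0-based indices).

data Var : Set where
  xv : ℕ → Var
  yv : ℕ → Var

_≟V_ : (u v : Var) → Dec (u ≡ v)
xv i ≟V xv j with i ≟ℕ j
... | yes refl = yes refl
... | no ne    = no λ { refl → ne refl }
xv i ≟V yv j = no λ ()
yv i ≟V xv j = no λ ()
yv i ≟V yv j with i ≟ℕ j
... | yes refl = yes refl
... | no ne    = no λ { refl → ne refl }

data Formula : Set where
  eqF   : Var → Var → Formula
  edgeF : Var → Var → Formula
  colF  : ℕ → Var → Formula
  negF  : Formula → Formula
  andF  : Formula → Formula → Formula
  orF   : Formula → Formula → Formula
  allF  : Var → Formula → Formula
  exF   : Var → Formula → Formula
  exGeF : ℕ → Var → Formula → Formula

Assignment : ColoredGraph → Set
Assignment G = Var → Fin (n G)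

update : {G : ColoredGraph} → Assignment G → Var → Fin (n G) → Assignment G
update a x v z with z ≟V x
... | yes _ = v
... | no _  = a z

Sat : (G : ColoredGraph) → Assignment G → Formula → Set
Sat G a (eqF x y)     = a x ≡ a y
Sat G a (edgeF x y)   = adj G (a x) (a y) ≡ true
Sat G a (colF c x)    = colour G (a x) ≡ c
Sat G a (negF φ)      = ¬ Sat G a φ
Sat G a (andF φ ψ)    = Sat G a φ × Sat G a ψ
Sat G a (orF φ ψ)     = Sat G a φ ⊎ Sat G a ψ
Sat G a (allF x φ)    = (v : Fin (n G)) → Sat G (update {G} a x v) φ
Sat G a (exF x φ)     = Σ (Fin (n G)) λ v → Sat G (update {G} a x v) φ
Sat G a (exGeF m x φ) =
  Σ (Fin m → Fin (n G)) λ f →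
    Injective _≡_ _≡_ f × ((i : Fin m) → Sat G (update {G} a x (f i)) φ)

-- A sentence holds in G (for sentences this is independent of the assignment).
Holds : ColoredGraph → Formula → Set
Holds G φ = (a : Assignment G) → Sat G a φ

Free : Var → Formula → Set
Free z (eqF x y)     = (z ≡ x) ⊎ (z ≡ y)
Free z (edgeF x y)   = (z ≡ x) ⊎ (z ≡ y)
Free z (colF c x)    = z ≡ x
Free z (negF φ)      = Free z φ
Free z (andF φ ψ)    = Free z φ ⊎ Free z ψ
Free z (orF φ ψ)     = Free z φ ⊎ Free z ψ
Free z (allF x φ)    = (x ≢ z) × Free z φ
Free z (exF x φ)     = (x ≢ z) × Free z φ
Free z (exGeF m x φ) = (x ≢ z) × Free z φ

Bound : Var → Formula → Set
Bound z (eqF x y)     = ⊥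
Bound z (edgeF x y)   = ⊥
Bound z (colF c x)    = ⊥
Bound z (negF φ)      = Bound z φ
Bound z (andF φ ψ)    = Bound z φ ⊎ Bound z ψ
Bound z (orF φ ψ)     = Bound z φ ⊎ Bound z ψ
Bound z (allF x φ)    = (x ≡ z) ⊎ Bound z φ
Bound z (exF x φ)     = (x ≡ z) ⊎ Bound z φ
Bound z (exGeF m x φ) = (x ≡ z) ⊎ Bound z φ

NestedQuant : Var → Formula → Set
NestedQuant z (eqF x y)     = ⊥
NestedQuant z (edgeF x y)   = ⊥
NestedQuant z (colF c x)    = ⊥
NestedQuant z (negF φ)      = NestedQuant z φ
NestedQuant z (andF φ ψ)    = NestedQuant z φ ⊎ NestedQuant z ψ
NestedQuant z (orF φ ψ)     = NestedQuant z φ ⊎ NestedQuant z ψ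
NestedQuant z (allF x φ)    = ((x ≡ z) × Bound z φ) ⊎ NestedQuant z φ
NestedQuant z (exF x φ)     = ((x ≡ z) × Bound z φ) ⊎ NestedQuant z φ
NestedQuant z (exGeF m x φ) = ((x ≡ z) × Bound z φ) ⊎ NestedQuant z φ

Requantified : Var → Formula → Set
Requantified z φ = (Free z φ × Bound z φ) ⊎ NestedQuant z φ

AllVars : (Var → Set) → Formula → Set
AllVars P (eqF x y)     = P x × P y
AllVars P (edgeF x y)   = P x × P y
AllVars P (colF c x)    = P x
AllVars P (negF φ)      = AllVars P φ
AllVars P (andF φ ψ)    = AllVars P φ × AllVars P ψ
AllVars P (orF φ ψ)     = AllVars P φ × AllVars P ψ
AllVars P (allF x φ)    = P x × AllVars P φ
AllVars P (exF x φ)     = P x × AllVars P φ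
AllVars P (exGeF m x φ) = P x × AllVars P φ

AllowedVar : ℕ → ℕ → Var → Set
AllowedVar k₁ k₂ (xv i) = i < k₁
AllowedVar k₁ k₂ (yv j) = j < k₂

C[_,_] : ℕ → ℕ → Formula → Set
C[ k₁ , k₂ ] φ = AllVars (AllowedVar k₁ k₂) φ × ((j : ℕ) → ¬ Requantified (yv j) φ)

Sentence : Formula → Set
Sentence φ = (z : Var) → ¬ Free z φ

Logic : Set₁
Logic = Formula → Set

Distinguishes : Logic → ColoredGraph → ColoredGraph → Set
Distinguishes L G H =
  Σ Formula λ φ → L φ × Sentence φ ×
    ((Holds G φ × ¬ Holds H φ) ⊎ (¬ Holds G φ × Holds H φ))

_⪯_ : Logic → Logic → Set
L ⪯ L' = (G H : ColoredGraph) → Distinguishes L G H → Distinguishes L' G H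

{-# OPTIONS --safe #-}
-- Let m = k₁' + k₂'. Over the complete graph on the parts 0, …, m take the
-- Cai–Fürer–Immerman graphs: a vertex is a part i with a label v : Part → Bool,
-- and (i, v), (j, w) with i ≠ j are adjacent when v j xor w i is the twist bit of
-- the base edge {i, j}; the untwisted graph has no twisted edge, the twisted one
-- exactly {0, o}. The sentence "there are v₀, …, v_m, pairwise adjacent, v_s of
-- colour s" uses m + 1 variables, each quantified once, so it lies in C^(k₁,k₂).
-- It holds in the untwisted graph (all labels 0), but not in the twisted one: the
-- labels of such a clique form a matrix with even rows, whose total parity would
-- equal the number of twisted edges. Conversely m pebbles never cover all m + 1
-- parts, and toggling labels inside an unpebbled part moves the twist while fixing
-- every pebbled vertex; this gives a bijective bisimulation for formulas over m
-- variables. Finally m ≥ 1, since C^(k₁',k₂') has to distinguish the one-vertex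
-- graphs of colours 0 and 1.
module Submission where

open import Defs
open import Algebra.Bundles using (CommutativeRing)
open import Data.Bool using (Bool; true; false; _xor_; _∧_; _∨_; not; if_then_else_)
open import Data.Bool.Properties
  using (xor-∧-commutativeRing; xor-assoc; xor-comm; xor-same; xor-identityʳ; ∧-comm; ∧-distribˡ-xor)
open import Data.Empty using (⊥-elim)
open import Data.Fin
  using (Fin; zero; suc; toℕ; fromℕ<; combine; quotient; remainder; funToFin; finToFun)
open import Data.Fin.Properties
  using (_≟_; suc-injective; toℕ-injective; toℕ<n; toℕ-fromℕ<; <-cmp; any?; ¬∀⟶∃¬; injective⇒≤;
         remQuot-combine; combine-remQuot; finToFun-funToFin; funToFin-finToFin; 2↔Bool)
open import Data.Nat using (ℕ; zero; suc; _+_; _*_; _∸_; _^_; _<_; _≤_; _<?_; s≤s; z≤n; s≤s⁻¹)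
open import Data.Nat.DivMod using (_mod_; m<n⇒m%n≡m)
open import Data.Nat.Properties
  using (≤-refl; ≤-trans; <⇒≤; <⇒≢; <⇒≱; ≤∧≢⇒<; n≤1+n; m≤n⇒m<n∨m≡n; m<1+n⇒m<n∨m≡n; <-irrefl; n≮n;
         ≮⇒≥; m≤m+n; +-suc; +-identityʳ; +-monoʳ-<; m+n≮m; m+n∸m≡n; ∸-monoˡ-<; ∸-cancelʳ-≡; m^n>0)
open import Data.Product using (Σ; ∃; _×_; _,_; proj₁; proj₂; map₂)
open import Data.Product.Function.Dependent.Propositional using (Σ-⇔)
open import Data.Product.Function.NonDependent.Propositional using (_×-⇔_)
open import Data.Sum using (inj₁; inj₂; [_,_]′)
open import Data.Sum.Function.Propositional using (_⊎-⇔_)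
open import Function using (_∘_; _⇔_; _↔_; mk⇔; mk↔ₛ′; Equivalence; Inverse; Injection)
open import Function.Definitions using (Injective)
open import Function.Properties.Inverse using (↔⇒↠; ↔⇒↣; ↔-sym)
open import Function.Related.TypeIsomorphisms using (¬-cong-⇔)
open import Relation.Binary.Definitions using (tri<; tri≈; tri>)
open import Relation.Binary.PropositionalEquality
  using (_≡_; _≢_; _≗_; refl; sym; trans; cong; cong₂; subst; subst₂; module ≡-Reasoning)
open import Relation.Nullary using (¬_; Dec; yes; no; does; contradiction)
open import Relation.Nullary.Decidable using (dec-true; dec-false; does-≡; map′)

module XorRing = CommutativeRing xor-∧-commutativeRing
open import Algebra.Properties.CommutativeMonoid.Sum XorRing.+-commutativeMonoid
  using (∑-distrib-+; sum-cong-≗; sum-replicate-zero) renaming (sum to parity)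
open import Algebra.Properties.CommutativeSemigroup XorRing.+-commutativeSemigroup
  using (interchange)

update-≡ : ∀ {G} (a : Assignment G) x v → update {G} a x v x ≡ v
update-≡ a x v with x ≟V x
... | yes _   = refl
... | no x≢x = ⊥-elim (x≢x refl)

update-≢ : ∀ {G} (a : Assignment G) {x y} v → y ≢ x → update {G} a x v y ≡ a y
update-≢ a {x} {y} v y≢x with y ≟V x
... | yes y≡x = ⊥-elim (y≢x y≡x)
... | no _    = refl

≡⇒⇔ : ∀ {A : Set} {x y z : A} → x ≡ y → (x ≡ z) ⇔ (y ≡ z)
≡⇒⇔ x≡y = mk⇔ (trans (sym x≡y)) (trans x≡y)

⇔-along : ∀ {A B : Set} (β : A ↔ B) {F : A → Set} {F' : B → Set} →
          (∀ v → F v ⇔ F' (Inverse.to β v)) → ∀ w → F (Inverse.from β w) ⇔ F' w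
⇔-along β {F} {F'} F⇔F' w =
  subst (λ w' → F (Inverse.from β w) ⇔ F' w') (Inverse.strictlyInverseˡ β w) (F⇔F' _)

record Bisimulation (G H : ColoredGraph) (P : Var → Set) : Set₁ where
  field
    _∼_              : Assignment G → Assignment H → Set
    ≡-preserved      : ∀ {a b x y} → a ∼ b → P x → P y → (a x ≡ a y) ⇔ (b x ≡ b y)
    adj-preserved    : ∀ {a b x y} → a ∼ b → P x → P y → adj G (a x) (a y) ≡ adj H (b x) (b y)
    colour-preserved : ∀ {a b x} → a ∼ b → P x → colour G (a x) ≡ colour H (b x)
    move             : ∀ {a b x} → a ∼ b → P x →
                       Σ (Fin (n G) ↔ Fin (n H)) λ β →
                         ∀ v → update {G} a x v ∼ update {H} b x (Inverse.to β v)
    forth            : ∀ a → ∃ λ b → a ∼ b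
    back             : ∀ b → ∃ λ a → a ∼ b

module _ {G H : ColoredGraph} {P : Var → Set} (B : Bisimulation G H P) where
  open Bisimulation B
  open Equivalence using (to; from)

  sat-preserved : ∀ φ → AllVars P φ → ∀ {a b} → a ∼ b → Sat G a φ ⇔ Sat H b φ
  sat-preserved (eqF x y)     (Px , Py) a∼b = ≡-preserved a∼b Px Py
  sat-preserved (edgeF x y)   (Px , Py) a∼b = ≡⇒⇔ (adj-preserved a∼b Px Py)
  sat-preserved (colF c x)    Px        a∼b = ≡⇒⇔ (colour-preserved a∼b Px)
  sat-preserved (negF φ)      Pφ        a∼b = ¬-cong-⇔ (sat-preserved φ Pφ a∼b)
  sat-preserved (andF φ ψ)    (Pφ , Pψ) a∼b = sat-preserved φ Pφ a∼b ×-⇔ sat-preserved ψ Pψ a∼b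
  sat-preserved (orF φ ψ)     (Pφ , Pψ) a∼b = sat-preserved φ Pφ a∼b ⊎-⇔ sat-preserved ψ Pψ a∼b
  sat-preserved (allF x φ)    (Px , Pφ) {a} {b} a∼b with move a∼b Px
  ... | β , moved = mk⇔ (λ G⊨ w → to (⇔-along β ih w) (G⊨ (Inverse.from β w)))
                        (λ H⊨ v → from (ih v) (H⊨ (Inverse.to β v)))
    where
    ih : ∀ v → Sat G (update {G} a x v) φ ⇔ Sat H (update {H} b x (Inverse.to β v)) φ
    ih v = sat-preserved φ Pφ (moved v)
  sat-preserved (exF x φ)     (Px , Pφ) a∼b with move a∼b Px
  ... | β , moved = Σ-⇔ (↔⇒↠ β) (sat-preserved φ Pφ (moved _))
  sat-preserved (exGeF m x φ) (Px , Pφ) {a} {b} a∼b with move a∼b Px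
  ... | β , moved = mk⇔
    (λ (f , f-inj , G⊨) → Inverse.to β ∘ f , f-inj ∘ Injection.injective (↔⇒↣ β) ,
                           λ i → to (ih (f i)) (G⊨ i))
    (λ (g , g-inj , H⊨) → Inverse.from β ∘ g , g-inj ∘ Injection.injective (↔⇒↣ (↔-sym β)) ,
                           λ i → from (⇔-along β {F' = λ w → Sat H (update {H} b x w) φ} ih (g i))
                                      (H⊨ i))
    where
    ih : ∀ v → Sat G (update {G} a x v) φ ⇔ Sat H (update {H} b x (Inverse.to β v)) φ
    ih v = sat-preserved φ Pφ (moved v)

  indistinguishable : (L : Logic) → (∀ {φ} → L φ → AllVars P φ) → ¬ Distinguishes L G H
  indistinguishable L L⇒P (φ , Lφ , _ , inj₁ (G⊨φ , H⊭φ)) =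
    H⊭φ λ b → let a , a∼b = back b in to (sat-preserved φ (L⇒P Lφ) a∼b) (G⊨φ a)
  indistinguishable L L⇒P (φ , Lφ , _ , inj₂ (G⊭φ , H⊨φ)) =
    G⊭φ λ a → let b , a∼b = forth a in from (sat-preserved φ (L⇒P Lφ) a∼b) (H⊨φ b)

var : ℕ → ℕ → Var
var k₁ s with s <? k₁
... | yes _ = xv s
... | no _  = yv (s ∸ k₁)

var-injective : ∀ k₁ → Injective _≡_ _≡_ (var k₁)
var-injective k₁ {s} {t} eq with s <? k₁ | t <? k₁ | eq
... | yes _   | yes _   | refl = refl
... | no s≮k₁ | no t≮k₁ | e    = ∸-cancelʳ-≡ (≮⇒≥ s≮k₁) (≮⇒≥ t≮k₁) (yv-injective e)
  where yv-injective : ∀ {i j} → yv i ≡ yv j → i ≡ j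
        yv-injective refl = refl

var-allowed : ∀ {k₁ k₂ s} → s < k₁ + k₂ → AllowedVar k₁ k₂ (var k₁ s)
var-allowed {k₁} {k₂} {s} s<k with s <? k₁
... | yes s<k₁ = s<k₁
... | no s≮k₁  = subst (s ∸ k₁ <_) (m+n∸m≡n k₁ k₂) (∸-monoˡ-< s<k (≮⇒≥ s≮k₁))

var-surjective : ∀ {k₁ k₂ x} → AllowedVar k₁ k₂ x → ∃ λ s → s < k₁ + k₂ × var k₁ s ≡ x
var-surjective {k₁} {k₂} {xv s} s<k₁ = s , ≤-trans s<k₁ (m≤m+n k₁ k₂) , var-x
  where
  var-x : var k₁ s ≡ xv s
  var-x with s <? k₁
  ... | yes _   = refl
  ... | no s≮k₁ = ⊥-elim (s≮k₁ s<k₁)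
var-surjective {k₁} {k₂} {yv j} j<k₂ = k₁ + j , +-monoʳ-< k₁ j<k₂ , var-y
  where
  var-y : var k₁ (k₁ + j) ≡ yv j
  var-y with k₁ + j <? k₁
  ... | yes k₁+j<k₁ = ⊥-elim (m+n≮m k₁ j k₁+j<k₁)
  ... | no _        = cong yv (m+n∸m≡n k₁ j)

allowed⇒var : ∀ {k₁ k₂ x} → AllowedVar k₁ k₂ x → ∃ λ (i : Fin (k₁ + k₂)) → var k₁ (toℕ i) ≡ x
allowed⇒var {k₁} Px with s , s<k , var-s≡x ← var-surjective Px =
  fromℕ< s<k , trans (cong (var k₁) (toℕ-fromℕ< s<k)) var-s≡x

some-variable : ∀ {P} φ → AllVars P φ → ∃ P
some-variable (eqF x y)     (Px , _) = x , Px
some-variable (edgeF x y)   (Px , _) = x , Px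
some-variable (colF c x)    Px       = x , Px
some-variable (negF φ)      Pφ       = some-variable φ Pφ
some-variable (andF φ ψ)    (Pφ , _) = some-variable φ Pφ
some-variable (orF φ ψ)     (Pφ , _) = some-variable φ Pφ
some-variable (allF x φ)    (Px , _) = x , Px
some-variable (exF x φ)     (Px , _) = x , Px
some-variable (exGeF m x φ) (Px , _) = x , Px

distinguishes⇒variable : ∀ {k₁ k₂ G H} → Distinguishes C[ k₁ , k₂ ] G H → Fin (k₁ + k₂)
distinguishes⇒variable (φ , (vars , _) , _) = proj₁ (allowed⇒var (proj₂ (some-variable φ vars)))

outside-image : ∀ {m} (f : Fin m → Fin (suc m)) → ∃ λ p → ∀ i → f i ≢ p
outside-image {m} f =
  map₂ (λ unhit i fi≡p → unhit (i , fi≡p)) (¬∀⟶∃¬ (suc m) _ (λ p → any? λ i → f i ≟ p) not-onto)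
  where
  not-onto : ¬ (∀ p → ∃ λ i → f i ≡ p)
  not-onto onto = n≮n m (injective⇒≤ section-injective)
    where
    section-injective : Injective _≡_ _≡_ (proj₁ ∘ onto)
    section-injective {p} {q} eq = trans (sym (proj₂ (onto p))) (trans (cong f eq) (proj₂ (onto q)))

xor-cancelʳ : ∀ x y → (x xor y) xor y ≡ x
xor-cancelʳ x y = trans (xor-assoc x y y) (trans (cong (x xor_) (xor-same y)) (xor-identityʳ x))

xor-cancel-shared : ∀ x y z → (x xor z) xor (y xor z) ≡ x xor y
xor-cancel-shared x y z =
  trans (interchange x z y z) (trans (cong ((x xor y) xor_) (xor-same z)) (xor-identityʳ _))

xor≡false⇒≡ : ∀ {x y} → x xor y ≡ false → x ≡ y
xor≡false⇒≡ {x} {y} x⊕y≡false = trans (sym (xor-cancelʳ x y)) (cong (_xor y) x⊕y≡false)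

δ : ∀ {k} → Fin k → Fin k → Bool
δ i j = does (i ≟ j)

δ-refl : ∀ {k} (i : Fin k) → δ i i ≡ true
δ-refl i = dec-true (i ≟ i) refl

δ-≢ : ∀ {k} {i j : Fin k} → i ≢ j → δ i j ≡ false
δ-≢ {i = i} {j} = dec-false (i ≟ j)

δ-sym : ∀ {k} (i j : Fin k) → δ i j ≡ δ j i
δ-sym i j = does-≡ (i ≟ j) (map′ sym sym (j ≟ i))

parity-unit : ∀ {k} (c : Fin k) → parity (λ j → δ j c) ≡ true
parity-unit {suc k} zero    = cong (true xor_) (sum-replicate-zero k)
parity-unit {suc k} (suc c) = parity-unit c

upperParity : ∀ {k} → (Fin k → Fin k → Bool) → Bool
upperParity {zero}  M = false
upperParity {suc k} M = parity (λ j → M zero (suc j)) xor upperParity (λ i j → M (suc i) (suc j))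

upperParity-cong : ∀ {k} {M M' : Fin k → Fin k → Bool} →
                   (∀ i j → i ≢ j → M i j ≡ M' i j) → upperParity M ≡ upperParity M'
upperParity-cong {zero}  M≡M' = refl
upperParity-cong {suc k} M≡M' =
  cong₂ _xor_ (sum-cong-≗ λ j → M≡M' zero (suc j) λ ())
              (upperParity-cong λ i j i≢j → M≡M' (suc i) (suc j) (i≢j ∘ suc-injective))

upperParity-false : ∀ {k} → upperParity {k} (λ _ _ → false) ≡ false
upperParity-false {zero}  = refl
upperParity-false {suc k} = cong₂ _xor_ (sum-replicate-zero k) (upperParity-false {k})

parity-entries : ∀ {k} (M : Fin k → Fin k → Bool) → (∀ i → M i i ≡ false) →
                 parity (λ i → parity (M i)) ≡ upperParity (λ i j → M i j xor M j i)
parity-entries {zero}  M M-diag = refl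
parity-entries {suc k} M M-diag = begin
  (M zero zero xor row) xor parity (λ i → M (suc i) zero xor parity (M (suc i) ∘ suc))
    ≡⟨ cong₂ (λ d r → (d xor row) xor r) (M-diag zero) (∑-distrib-+ (λ i → M (suc i) zero) _) ⟩
  row xor (column xor parity (λ i → parity (M (suc i) ∘ suc)))
    ≡⟨ cong (λ r → row xor (column xor r)) (parity-entries (λ i j → M (suc i) (suc j)) (M-diag ∘ suc)) ⟩
  row xor (column xor upper)
    ≡⟨ xor-assoc row column upper ⟨
  (row xor column) xor upper
    ≡⟨ cong (_xor upper) (∑-distrib-+ (λ j → M zero (suc j)) (λ j → M (suc j) zero)) ⟨
  parity (λ j → M zero (suc j) xor M (suc j) zero) xor upper ∎
  where
  open ≡-Reasoning
  row column upper : Bool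
  row = parity (λ j → M zero (suc j))
  column = parity (λ i → M (suc i) zero)
  upper = upperParity (λ i j → M (suc i) (suc j) xor M (suc j) (suc i))

EvenLabelling : ∀ {k} → (Fin k → Fin k → Bool) → (Fin k → Fin k → Bool) → Set
EvenLabelling T M =
  (∀ i → M i i ≡ false) × (∀ i → parity (M i) ≡ false) × (∀ i j → i ≢ j → M i j xor M j i ≡ T i j)

evenLabelling⇒upperParity : ∀ {k} {T M : Fin k → Fin k → Bool} →
                            EvenLabelling T M → upperParity T ≡ false
evenLabelling⇒upperParity {k} {T} {M} (M-diag , M-even , M-twist) = begin
  upperParity T                         ≡⟨ upperParity-cong (λ i j i≢j → sym (M-twist i j i≢j)) ⟩
  upperParity (λ i j → M i j xor M j i) ≡⟨ parity-entries M M-diag ⟨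
  parity (λ i → parity (M i))           ≡⟨ sum-cong-≗ M-even ⟩
  parity {k} (λ _ → false)              ≡⟨ sum-replicate-zero k ⟩
  false                                 ∎
  where open ≡-Reasoning

Placed : (G : ColoredGraph) → (ℕ → Fin (n G)) → ℕ → Set
Placed G c t = colour G (c t) ≡ t × (∀ s → s < t → adj G (c s) (c t) ≡ true)

RainbowFrom : (G : ColoredGraph) → ℕ → ℕ → (ℕ → Fin (n G)) → Set
RainbowFrom G t m c = ∀ s → t ≤ s → s ≤ m → Placed G c s

Rainbow : ColoredGraph → ℕ → Set
Rainbow G r = ∃ (RainbowFrom G 0 r)

Placed-cong : ∀ {G c c' t} → (∀ s → s ≤ t → c s ≡ c' s) → Placed G c t → Placed G c' t
Placed-cong {G} {t = t} c≡c' (col , adjs) =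
  trans (cong (colour G) (sym (c≡c' t ≤-refl))) col ,
  λ s s<t → trans (cong₂ (adj G) (sym (c≡c' s (<⇒≤ s<t))) (sym (c≡c' t ≤-refl))) (adjs s s<t)

RainbowFrom-cons : ∀ {G c t m} → Placed G c t → RainbowFrom G (suc t) m c → RainbowFrom G t m c
RainbowFrom-cons placed rainbow s t≤s s≤m with m≤n⇒m<n∨m≡n t≤s
... | inj₁ t<s  = rainbow s t<s s≤m
... | inj₂ refl = placed

module RainbowClique (k₁ : ℕ) where

  v : ℕ → Var
  v = var k₁

  attach : ℕ → ℕ → Formula
  attach t zero    = colF t (v t)
  attach t (suc s) = andF (edgeF (v s) (v t)) (attach t s)

  -- clique r t binds v t, …, v (t + r) to a rainbow clique extending v 0, …, v (t - 1).
  clique : ℕ → ℕ → Formula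
  clique zero    t = exF (v t) (attach t t)
  clique (suc r) t = exF (v t) (andF (attach t t) (clique r (suc t)))

  attach-vars : ∀ {P t} s → s ≤ t → (∀ {s'} → s' ≤ t → P (v s')) → AllVars P (attach t s)
  attach-vars zero    s≤t Pv = Pv ≤-refl
  attach-vars (suc s) s<t Pv = (Pv (<⇒≤ s<t) , Pv ≤-refl) , attach-vars s (<⇒≤ s<t) Pv

  clique-vars : ∀ {P} r t → (∀ {s} → s ≤ t + r → P (v s)) → AllVars P (clique r t)
  clique-vars zero    t Pv = Pv (m≤m+n t 0) , attach-vars t ≤-refl (Pv ∘ λ s≤t → ≤-trans s≤t (m≤m+n t 0))
  clique-vars (suc r) t Pv =
    Pv (m≤m+n t _) , attach-vars t ≤-refl (Pv ∘ λ s≤t → ≤-trans s≤t (m≤m+n t _)) ,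
    clique-vars r (suc t) λ {s} s≤ → Pv (subst (s ≤_) (sym (+-suc t r)) s≤)

  attach-free : ∀ {z t} s → s ≤ t → Free z (attach t s) → ∃ λ s' → s' ≤ t × z ≡ v s'
  attach-free zero    _   z≡vt                 = _ , ≤-refl , z≡vt
  attach-free (suc s) s<t (inj₁ (inj₁ z≡vs)) = s , <⇒≤ s<t , z≡vs
  attach-free (suc s) s<t (inj₁ (inj₂ z≡vt)) = _ , ≤-refl , z≡vt
  attach-free (suc s) s<t (inj₂ z∈φ)         = attach-free s (<⇒≤ s<t) z∈φ

  attach-unbound : ∀ {z t} s → ¬ Bound z (attach t s)
  attach-unbound zero    ()
  attach-unbound (suc s) (inj₂ b) = attach-unbound s b

  attach-unnested : ∀ {z t} s → ¬ NestedQuant z (attach t s)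
  attach-unnested zero    ()
  attach-unnested (suc s) (inj₂ b) = attach-unnested s b

  strictly-below : ∀ {z t} → v t ≢ z → (∃ λ s → s ≤ t × z ≡ v s) → ∃ λ s → s < t × z ≡ v s
  strictly-below vt≢z (s , s≤t , z≡vs) = s , ≤∧≢⇒< s≤t (λ { refl → vt≢z (sym z≡vs) }) , z≡vs

  clique-free : ∀ {z} r t → Free z (clique r t) → ∃ λ s → s < t × z ≡ v s
  clique-free zero    t (vt≢z , z∈φ)      = strictly-below vt≢z (attach-free t ≤-refl z∈φ)
  clique-free (suc r) t (vt≢z , inj₁ z∈φ) = strictly-below vt≢z (attach-free t ≤-refl z∈φ)
  clique-free (suc r) t (vt≢z , inj₂ z∈φ) with s , s<1+t , z≡vs ← clique-free r (suc t) z∈φ =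
    strictly-below vt≢z (s , s≤s⁻¹ s<1+t , z≡vs)

  clique-bound : ∀ {z} r t → Bound z (clique r t) → ∃ λ s → t ≤ s × z ≡ v s
  clique-bound zero    t (inj₁ vt≡z)        = t , ≤-refl , sym vt≡z
  clique-bound zero    t (inj₂ b)           = ⊥-elim (attach-unbound t b)
  clique-bound (suc r) t (inj₁ vt≡z)        = t , ≤-refl , sym vt≡z
  clique-bound (suc r) t (inj₂ (inj₁ b))    = ⊥-elim (attach-unbound t b)
  clique-bound (suc r) t (inj₂ (inj₂ b)) with s , t<s , z≡vs ← clique-bound r (suc t) b =
    s , <⇒≤ t<s , z≡vs

  clique-unnested : ∀ {z} r t → ¬ NestedQuant z (clique r t)
  clique-unnested zero    t (inj₁ (_ , b))            = attach-unbound t b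
  clique-unnested zero    t (inj₂ nested)             = attach-unnested t nested
  clique-unnested (suc r) t (inj₁ (_ , inj₁ b))       = attach-unbound t b
  clique-unnested (suc r) t (inj₁ (vt≡z , inj₂ b)) with s , t<s , z≡vs ← clique-bound r (suc t) b =
    <⇒≢ t<s (var-injective k₁ (trans vt≡z z≡vs))
  clique-unnested (suc r) t (inj₂ (inj₁ nested))      = attach-unnested t nested
  clique-unnested (suc r) t (inj₂ (inj₂ nested))      = clique-unnested r (suc t) nested

  clique-sentence : ∀ r → Sentence (clique r 0)
  clique-sentence r z z∈φ with () ← proj₁ (proj₂ (clique-free r 0 z∈φ))

  clique∈C : ∀ {k₂ r} → r < k₁ + k₂ → C[ k₁ , k₂ ] (clique r 0)
  clique∈C {r = r} r<k =
    clique-vars r 0 (λ s≤r → var-allowed (≤-trans (s≤s s≤r) r<k)) ,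
    λ { j (inj₁ (free , _)) → clique-sentence r (yv j) free
      ; j (inj₂ nested)     → clique-unnested r 0 nested }

  module _ {G : ColoredGraph} where

    attach-sat : ∀ {a t} s → Sat G a (attach t s) ⇔
                 (colour G (a (v t)) ≡ t × ∀ s' → s' < s → adj G (a (v s')) (a (v t)) ≡ true)
    attach-sat zero    = mk⇔ (λ col → col , λ _ ()) proj₁
    attach-sat {a} {t} (suc s) = mk⇔
      (λ (e , rest) → let col , adjs = Equivalence.to (attach-sat s) rest in
         col , λ s' s'<1+s → [ adjs s' , (λ { refl → e }) ]′ (m<1+n⇒m<n∨m≡n s'<1+s))
      (λ (col , adjs) → adjs s ≤-refl ,
         Equivalence.from (attach-sat s) (col , λ s' s'<s → adjs s' (≤-trans s'<s (n≤1+n s))))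

    update-earlier : ∀ (a : Assignment G) {s t} w → s < t → update {G} a (v t) w (v s) ≡ a (v s)
    update-earlier a w s<t = update-≢ {G} a w (<⇒≢ s<t ∘ var-injective k₁)

    extend-agrees : ∀ {a : Assignment G} {c : ℕ → Fin (n G)} {t} → (∀ s → s < t → a (v s) ≡ c s) →
             ∀ s → s < suc t → update {G} a (v t) (c t) (v s) ≡ c s
    extend-agrees {a} {c} {t} a≡c s s<1+t with m<1+n⇒m<n∨m≡n s<1+t
    ... | inj₁ s<t  = trans (update-earlier a (c t) s<t) (a≡c s s<t)
    ... | inj₂ refl = update-≡ {G} a (v s) (c s)

    extend-attach : ∀ {a : Assignment G} {c : ℕ → Fin (n G)} {t} →
                    (∀ s → s < t → a (v s) ≡ c s) → Placed G c t →
                    Sat G (update {G} a (v t) (c t)) (attach t t)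
    extend-attach {a} {c} {t} a≡c placed =
      Equivalence.from (attach-sat t)
        (Placed-cong {G} (λ s s≤t → sym (extend-agrees {a} {c} a≡c s (s≤s s≤t))) placed)

    clique-intro : ∀ r t {a : Assignment G} {c : ℕ → Fin (n G)} →
                   RainbowFrom G t (t + r) c → (∀ s → s < t → a (v s) ≡ c s) → Sat G a (clique r t)
    clique-intro zero    t {a} {c} rainbow a≡c =
      c t , extend-attach {a} {c} a≡c (rainbow t ≤-refl (m≤m+n t 0))
    clique-intro (suc r) t {a} {c} rainbow a≡c =
      c t , extend-attach {a} {c} a≡c (rainbow t ≤-refl (m≤m+n t _)) ,
      clique-intro r (suc t) (λ s t<s s≤ → rainbow s (<⇒≤ t<s) (subst (s ≤_) (sym (+-suc t r)) s≤))
                             (extend-agrees {a} {c} a≡c)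

    clique-elim : ∀ r t {a : Assignment G} → Sat G a (clique r t) →
                  ∃ λ c → (∀ s → s < t → a (v s) ≡ c s) × RainbowFrom G t (t + r) c
    clique-elim zero    t {a} (w , attached) =
      (λ s → update {G} a (v t) w (v s)) , (λ s s<t → sym (update-earlier a w s<t)) ,
      RainbowFrom-cons {G} (Equivalence.to (attach-sat t) attached)
        (λ s t<s s≤t+0 → ⊥-elim (<⇒≱ t<s (subst (s ≤_) (+-identityʳ t) s≤t+0)))
    clique-elim (suc r) t {a} (w , attached , rest)
      with c , a'≡c , rainbow ← clique-elim r (suc t) rest =
      c , (λ s s<t → trans (sym (update-earlier a w s<t)) (a'≡c s (≤-trans s<t (n≤1+n t)))) ,
      RainbowFrom-cons {G}
        (Placed-cong {G} (λ s s≤t → a'≡c s (s≤s s≤t)) (Equivalence.to (attach-sat t) attached))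
        (λ s t<s s≤ → rainbow s t<s (subst (s ≤_) (+-suc t r) s≤))

  rainbow-distinguishes : ∀ {k₂ r G H} → r < k₁ + k₂ → Rainbow G r → ¬ Rainbow H r →
                          Distinguishes C[ k₁ , k₂ ] G H
  rainbow-distinguishes {r = r} {H = H} r<k (_ , rainbow) no-rainbow =
    clique r 0 , clique∈C r<k , clique-sentence r ,
    inj₁ ((λ a → clique-intro r 0 rainbow λ _ ()) ,
          λ H⊨ → no-rainbow (map₂ proj₂ (clique-elim r 0 (H⊨ λ _ → vertex₀))))
    where
    vertex₀ : Fin (n H)
    vertex₀ = fromℕ< (nonempty H)

funToFin-cong : ∀ {k n} {f g : Fin k → Fin n} → f ≗ g → funToFin f ≡ funToFin g
funToFin-cong {zero}  f≗g = refl
funToFin-cong {suc k} f≗g = cong₂ combine (f≗g zero) (funToFin-cong (f≗g ∘ suc))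

module CFI (m : ℕ) where

  Part : Set
  Part = Fin (suc m)

  Label : Set
  Label = Part → Bool

  Twist : Set
  Twist = Part → Part → Bool

  Vertex : Set
  Vertex = Fin (suc m * 2 ^ suc m)

  open Inverse 2↔Bool using () renaming
    ( to to toBool ; from to fromBool
    ; strictlyInverseˡ to toBool-fromBool ; strictlyInverseʳ to fromBool-toBool )

  encode : Label → Fin (2 ^ suc m)
  encode v = funToFin (fromBool ∘ v)

  decode : Fin (2 ^ suc m) → Label
  decode c = toBool ∘ finToFun c

  encode-cong : ∀ {v w} → v ≗ w → encode v ≡ encode w
  encode-cong v≗w = funToFin-cong (cong fromBool ∘ v≗w)

  decode-encode : ∀ v j → decode (encode v) j ≡ v j
  decode-encode v j = trans (cong toBool (finToFun-funToFin (fromBool ∘ v) j)) (toBool-fromBool (v j))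

  encode-decode : ∀ c → encode (decode c) ≡ c
  encode-decode c =
    trans (funToFin-cong {suc m} {2} (fromBool-toBool ∘ finToFun c)) (funToFin-finToFin {suc m} {2} c)

  vertex : Part → Label → Vertex
  vertex i v = combine i (encode v)

  part : Vertex → Part
  part = quotient (2 ^ suc m)

  label : Vertex → Label
  label u = decode (remainder {suc m} (2 ^ suc m) u)

  part-vertex : ∀ i v → part (vertex i v) ≡ i
  part-vertex i v = cong proj₁ (remQuot-combine {k = 2 ^ suc m} i _)

  label-vertex : ∀ i v j → label (vertex i v) j ≡ v j
  label-vertex i v j =
    trans (cong (λ r → decode (proj₂ r) j) (remQuot-combine {k = 2 ^ suc m} i (encode v)))
          (decode-encode v j)

  vertex-≡ : ∀ {u i v} → i ≡ part u → (∀ j → v j ≡ label u j) → vertex i v ≡ u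
  vertex-≡ {u} {v = v} refl v≡label = begin
    combine (part u) (encode v)                        ≡⟨ cong (combine (part u)) (encode-cong v≡label) ⟩
    combine (part u) (encode (label u))                ≡⟨ cong (combine (part u)) (encode-decode _) ⟩
    combine (part u) (remainder {suc m} (2 ^ suc m) u) ≡⟨ combine-remQuot {suc m} (2 ^ suc m) u ⟩
    u                                                  ∎
    where open ≡-Reasoning

  mismatch : Twist → Vertex → Vertex → Bool
  mismatch T u w = (label u (part w) xor label w (part u)) xor T (part u) (part w)

  adjacent : Twist → Vertex → Vertex → Bool
  adjacent T u w = not (δ (part u) (part w)) ∧ not (mismatch T u w)

  -- Labels that are not even vectors vanishing at their own part mark junk
  -- vertices; they get the colour suc m, which no part has.
  vertexColour : Vertex → ℕ
  vertexColour u = if label u (part u) ∨ parity (label u) then suc m else toℕ (part u)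

  cfi : (T : Twist) → (∀ i j → T i j ≡ T j i) → ColoredGraph
  cfi T T-sym = record
    { n        = suc m * 2 ^ suc m
    ; nonempty = ≤-trans (m^n>0 2 (suc m)) (m≤m+n (2 ^ suc m) (m * 2 ^ suc m))
    ; adj      = adjacent T
    ; adj-sym  = λ u w →
        cong₂ (λ d e → not d ∧ not e) (δ-sym (part u) (part w))
              (cong₂ _xor_ (xor-comm (label u (part w)) (label w (part u))) (T-sym (part u) (part w)))
    ; adj-irr  = λ u → cong (λ d → not d ∧ not (mismatch T u u)) (δ-refl (part u))
    ; colour   = vertexColour
    }

  adjacent-cong : ∀ {T T' u w} → T (part u) (part w) ≡ T' (part u) (part w) →
                  adjacent T u w ≡ adjacent T' u w
  adjacent-cong {u = u} {w} T≡T' =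
    cong (λ t → not (δ (part u) (part w)) ∧ not ((label u (part w) xor label w (part u)) xor t)) T≡T'

  vertexColour-cong : ∀ {u w} → part u ≡ part w → label u (part u) ≡ label w (part w) →
                      parity (label u) ≡ parity (label w) → vertexColour u ≡ vertexColour w
  vertexColour-cong {u} {w} part≡ own≡ parity≡ =
    cong₂ (λ b i → if b then suc m else toℕ i) (cong₂ _∨_ own≡ parity≡) part≡

  toggle : (Part → Label) → Vertex → Vertex
  toggle f u = vertex (part u) (λ j → label u j xor f (part u) j)

  part-toggle : ∀ f u → part (toggle f u) ≡ part u
  part-toggle f u = part-vertex (part u) (λ j → label u j xor f (part u) j)

  label-toggle : ∀ f u j → label (toggle f u) j ≡ label u j xor f (part u) j
  label-toggle f u = label-vertex (part u) (λ j → label u j xor f (part u) j)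

  toggle-involutive : ∀ f u → toggle f (toggle f u) ≡ u
  toggle-involutive f u = vertex-≡ (part-toggle f u) λ j →
    trans (cong₂ (λ l i → l xor f i j) (label-toggle f u j) (part-toggle f u))
          (xor-cancelʳ (label u j) _)

  toggle-trivial : ∀ f u → (∀ j → f (part u) j ≡ false) → toggle f u ≡ u
  toggle-trivial f u f≡false =
    vertex-≡ refl λ j → trans (cong (label u j xor_) (f≡false j)) (xor-identityʳ _)

  Balanced : (Part → Label) → Set
  Balanced f = (∀ i → f i i ≡ false) × (∀ i → parity (f i) ≡ false)

  vertexColour-toggle : ∀ {f} → Balanced f → ∀ u → vertexColour (toggle f u) ≡ vertexColour u
  vertexColour-toggle {f} (f-diag , f-even) u = vertexColour-cong (part-toggle f u) own parity≡
    where
    i : Part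
    i = part u
    own : label (toggle f u) (part (toggle f u)) ≡ label u i
    own = begin
      label (toggle f u) (part (toggle f u)) ≡⟨ cong (label (toggle f u)) (part-toggle f u) ⟩
      label (toggle f u) i                   ≡⟨ label-toggle f u i ⟩
      label u i xor f i i                    ≡⟨ cong (label u i xor_) (f-diag i) ⟩
      label u i xor false                    ≡⟨ xor-identityʳ _ ⟩
      label u i                              ∎
      where open ≡-Reasoning
    parity≡ : parity (label (toggle f u)) ≡ parity (label u)
    parity≡ = begin
      parity (label (toggle f u))              ≡⟨ sum-cong-≗ (label-toggle f u) ⟩
      parity (λ j → label u j xor f i j)       ≡⟨ ∑-distrib-+ (label u) (f i) ⟩
      parity (label u) xor parity (f i)        ≡⟨ cong (parity (label u) xor_) (f-even i) ⟩
      parity (label u) xor false               ≡⟨ xor-identityʳ _ ⟩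
      parity (label u)                         ∎
      where open ≡-Reasoning

  mismatch-toggle : ∀ {T T' f} → (∀ i j → T' i j ≡ T i j xor (f i j xor f j i)) →
                    ∀ u w → mismatch T' (toggle f u) (toggle f w) ≡ mismatch T u w
  mismatch-toggle {T} {T'} {f} T'≡ u w
    rewrite part-toggle f u | part-toggle f w | label-toggle f u (part w) | label-toggle f w (part u)
          | T'≡ (part u) (part w) = begin
    ((a xor fᵢⱼ) xor (b xor fⱼᵢ)) xor (t xor fᵢⱼ⊕fⱼᵢ) ≡⟨ cong (_xor (t xor fᵢⱼ⊕fⱼᵢ)) (interchange a fᵢⱼ b fⱼᵢ) ⟩
    ((a xor b) xor fᵢⱼ⊕fⱼᵢ) xor (t xor fᵢⱼ⊕fⱼᵢ)       ≡⟨ xor-cancel-shared (a xor b) t fᵢⱼ⊕fⱼᵢ ⟩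
    (a xor b) xor t                                   ∎
    where
    open ≡-Reasoning
    a b t fᵢⱼ fⱼᵢ fᵢⱼ⊕fⱼᵢ : Bool
    a = label u (part w)
    b = label w (part u)
    t = T (part u) (part w)
    fᵢⱼ = f (part u) (part w)
    fⱼᵢ = f (part w) (part u)
    fᵢⱼ⊕fⱼᵢ = fᵢⱼ xor fⱼᵢ

  adjacent-toggle : ∀ {T T' f} → (∀ i j → T' i j ≡ T i j xor (f i j xor f j i)) →
                    ∀ u w → adjacent T' (toggle f u) (toggle f w) ≡ adjacent T u w
  adjacent-toggle {T} {T'} {f} T'≡ u w =
    cong₂ (λ d e → not d ∧ not e) (cong₂ δ (part-toggle f u) (part-toggle f w))
          (mismatch-toggle {T} {T'} {f} T'≡ u w)

  record _≅_ (T T' : Twist) : Set where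
    field
      to          : Vertex → Vertex
      from        : Vertex → Vertex
      from-to     : ∀ u → from (to u) ≡ u
      to-from     : ∀ u → to (from u) ≡ u
      part-to     : ∀ u → part (to u) ≡ part u
      adjacent-to : ∀ u w → adjacent T' (to u) (to w) ≡ adjacent T u w
      colour-to   : ∀ u → vertexColour (to u) ≡ vertexColour u

    bijection : Vertex ↔ Vertex
    bijection = mk↔ₛ′ to from to-from from-to

    to-injective : ∀ {u w} → to u ≡ to w → u ≡ w
    to-injective {u} {w} to-u≡to-w = trans (sym (from-to u)) (trans (cong from to-u≡to-w) (from-to w))

    part-from : ∀ u → part (from u) ≡ part u
    part-from u = trans (sym (part-to (from u))) (cong part (to-from u))

  open _≅_

  ≅-reflexive : ∀ {T T'} → (∀ i j → T i j ≡ T' i j) → T ≅ T'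
  ≅-reflexive {T} {T'} T≡T' = record
    { to          = λ u → u
    ; from        = λ u → u
    ; from-to     = λ _ → refl
    ; to-from     = λ _ → refl
    ; part-to     = λ _ → refl
    ; adjacent-to = λ u w → sym (adjacent-cong {T} {T'} (T≡T' (part u) (part w)))
    ; colour-to   = λ _ → refl
    }

  ≅-trans : ∀ {T T' T''} → T ≅ T' → T' ≅ T'' → T ≅ T''
  ≅-trans σ π = record
    { to          = to π ∘ to σ
    ; from        = from σ ∘ from π
    ; from-to     = λ u → trans (cong (from σ) (from-to π (to σ u))) (from-to σ u)
    ; to-from     = λ u → trans (cong (to π) (to-from σ (from π u))) (to-from π u)
    ; part-to     = λ u → trans (part-to π (to σ u)) (part-to σ u)
    ; adjacent-to = λ u w → trans (adjacent-to π (to σ u) (to σ w)) (adjacent-to σ u w)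
    ; colour-to   = λ u → trans (colour-to π (to σ u)) (colour-to σ u)
    }

  toggle-≅ : ∀ {T T' f} → Balanced f → (∀ i j → T' i j ≡ T i j xor (f i j xor f j i)) → T ≅ T'
  toggle-≅ {T} {T'} {f} f-balanced T'≡ = record
    { to          = toggle f
    ; from        = toggle f
    ; from-to     = toggle-involutive f
    ; to-from     = toggle-involutive f
    ; part-to     = part-toggle f
    ; adjacent-to = adjacent-toggle {T} {T'} {f} T'≡
    ; colour-to   = vertexColour-toggle {f} f-balanced
    }

  row : Part → Label → Part → Label
  row p e i j = δ i p ∧ e j

  star : Part → Label → Twist
  star p e i j = row p e i j xor row p e j i

  edge : Part → Part → Twist
  edge p q = star p (λ j → δ j q)

  star-xor : ∀ p e e' i j → star p (λ k → e k xor e' k) i j ≡ star p e i j xor star p e' i j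
  star-xor p e e' i j =
    trans (cong₂ _xor_ (∧-distribˡ-xor (δ i p) (e j) (e' j)) (∧-distribˡ-xor (δ j p) (e i) (e' i)))
          (interchange (row p e i j) (row p e' i j) (row p e j i) (row p e' j i))

  edge-sym : ∀ p q i j → edge p q i j ≡ edge p q j i
  edge-sym p q i j = xor-comm (δ i p ∧ δ j q) (δ j p ∧ δ i q)

  edge-comm : ∀ p q i j → edge p q i j ≡ edge q p i j
  edge-comm p q i j =
    trans (cong₂ _xor_ (∧-comm (δ i p) (δ j q)) (∧-comm (δ j p) (δ i q)))
          (xor-comm (δ j q ∧ δ i p) (δ i q ∧ δ j p))

  edge-outside : ∀ {p} q {i j} → i ≢ p → j ≢ p → edge p q i j ≡ false
  edge-outside q i≢p j≢p rewrite δ-≢ i≢p | δ-≢ j≢p = refl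

  row-balanced : ∀ {p e} → e p ≡ false → parity e ≡ false → Balanced (row p e)
  row-balanced {p} {e} e-own e-even = diag , even
    where
    diag : ∀ i → δ i p ∧ e i ≡ false
    diag i with i ≟ p
    ... | yes refl = e-own
    ... | no _     = refl
    even : ∀ i → parity (λ j → δ i p ∧ e j) ≡ false
    even i with does (i ≟ p)
    ... | true  = e-even
    ... | false = sum-replicate-zero (suc m)

  bits : Part → Part → Label
  bits q q' j = δ j q xor δ j q'

  -- Toggling at p the bits towards q and q' moves the twist from {p, q} to {p, q'}.
  shift : ∀ {p q q'} → p ≢ q → p ≢ q' → edge p q ≅ edge p q'
  shift {p} {q} {q'} p≢q p≢q' =
    toggle-≅ {edge p q} {edge p q'} {row p (bits q q')} (row-balanced {p} {bits q q'} own even) moved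
    where
    own : bits q q' p ≡ false
    own rewrite δ-≢ p≢q | δ-≢ p≢q' = refl
    even : parity (bits q q') ≡ false
    even = begin
      parity (bits q q')                             ≡⟨ ∑-distrib-+ (λ j → δ j q) (λ j → δ j q') ⟩
      parity (λ j → δ j q) xor parity (λ j → δ j q') ≡⟨ cong₂ _xor_ (parity-unit q) (parity-unit q') ⟩
      false                                          ∎
      where open ≡-Reasoning
    moved : ∀ i j → edge p q' i j ≡ edge p q i j xor star p (bits q q') i j
    moved i j = sym (begin
      x xor star p (bits q q') i j ≡⟨ cong (x xor_) (star-xor p (λ k → δ k q) (λ k → δ k q') i j) ⟩
      x xor (x xor y)              ≡⟨ xor-assoc x x y ⟨
      (x xor x) xor y              ≡⟨ cong (_xor y) (xor-same x) ⟩
      y                            ∎)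
      where
      open ≡-Reasoning
      x y : Bool
      x = edge p q i j
      y = edge p q' i j

  shift-outside : ∀ {p q q'} (p≢q : p ≢ q) (p≢q' : p ≢ q') {u} → part u ≢ p → to (shift p≢q p≢q') u ≡ u
  shift-outside {p} {q} {q'} _ _ {u} u∉p =
    toggle-trivial (row p (bits q q')) u λ j → cong (_∧ bits q q' j) (δ-≢ u∉p)

  noTwist : Twist
  noTwist _ _ = false

  untwisted : ColoredGraph
  untwisted = cfi noTwist (λ _ _ → refl)

  twisted : Fin m → ColoredGraph
  twisted o = cfi (edge zero (suc o)) (edge-sym zero (suc o))

  upperParity-edge : ∀ o → upperParity (edge zero (suc o)) ≡ true
  upperParity-edge o =
    cong₂ _xor_ (trans (sum-cong-≗ λ j → xor-identityʳ (δ j o)) (parity-unit o)) (upperParity-false {m})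

  vertexColour-vertex : ∀ i v → v i ≡ false → parity v ≡ false → vertexColour (vertex i v) ≡ toℕ i
  vertexColour-vertex i v v-own v-even
    rewrite part-vertex i v | label-vertex i v i | sum-cong-≗ (label-vertex i v) | v-own | v-even = refl

  vertexColour≡part : ∀ u i → vertexColour u ≡ toℕ i →
                      part u ≡ i × label u (part u) ≡ false × parity (label u) ≡ false
  vertexColour≡part u i colour≡i with label u (part u) | parity (label u)
  ... | false | false = toℕ-injective colour≡i , refl , refl
  ... | true  | _     = ⊥-elim (<-irrefl (sym colour≡i) (toℕ<n i))
  ... | false | true  = ⊥-elim (<-irrefl (sym colour≡i) (toℕ<n i))

  adjacent⇒matching : ∀ T u w → adjacent T u w ≡ true →
                      label u (part w) xor label w (part u) ≡ T (part u) (part w)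
  adjacent⇒matching T u w adjacent≡true = xor≡false⇒≡ (unmismatched _ _ adjacent≡true)
    where
    unmismatched : ∀ d e → not d ∧ not e ≡ true → e ≡ false
    unmismatched false false _ = refl

  zeros : Label
  zeros _ = false

  adjacent-zeros : ∀ {i j} → i ≢ j → adjacent noTwist (vertex i zeros) (vertex j zeros) ≡ true
  adjacent-zeros {i} {j} i≢j
    rewrite part-vertex i zeros | part-vertex j zeros | label-vertex i zeros j | label-vertex j zeros i
          | δ-≢ i≢j = refl

  untwisted-rainbow : Rainbow untwisted m
  untwisted-rainbow = c , λ s _ s≤m → placed s≤m
    where
    c : ℕ → Vertex
    c s = vertex (s mod suc m) zeros
    toℕ-mod : ∀ {s} → s ≤ m → toℕ (s mod suc m) ≡ s
    toℕ-mod {s} s≤m = trans (toℕ-fromℕ< _) (m<n⇒m%n≡m (s≤s s≤m))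
    placed : ∀ {s} → s ≤ m → Placed untwisted c s
    placed s≤m =
      trans (vertexColour-vertex _ zeros refl (sum-replicate-zero (suc m))) (toℕ-mod s≤m) ,
      λ s' s'<s → adjacent-zeros λ mod≡ →
        <⇒≢ s'<s (trans (sym (toℕ-mod (≤-trans (<⇒≤ s'<s) s≤m))) (trans (cong toℕ mod≡) (toℕ-mod s≤m)))

  rainbow⇒evenLabelling : ∀ {T} (T-sym : ∀ i j → T i j ≡ T j i) {c} → RainbowFrom (cfi T T-sym) 0 m c →
                          EvenLabelling T (λ i → label (c (toℕ i)))
  rainbow⇒evenLabelling {T} T-sym {c} rainbow = M-diag , (proj₂ ∘ proj₂ ∘ good) , M-twist
    where
    u : Part → Vertex
    u i = c (toℕ i)
    M : Part → Label
    M i = label (u i)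
    placed : ∀ i → Placed (cfi T T-sym) c (toℕ i)
    placed i = rainbow (toℕ i) z≤n (s≤s⁻¹ (toℕ<n i))
    good : ∀ i → part (u i) ≡ i × label (u i) (part (u i)) ≡ false × parity (label (u i)) ≡ false
    good i = vertexColour≡part (u i) i (proj₁ (placed i))
    M-diag : ∀ i → M i i ≡ false
    M-diag i = subst (λ j → M i j ≡ false) (proj₁ (good i)) (proj₁ (proj₂ (good i)))
    M-twist< : ∀ {i j} → toℕ i < toℕ j → M i j xor M j i ≡ T i j
    M-twist< {i} {j} i<j =
      subst₂ (λ i' j' → M i j' xor M j i' ≡ T i' j') (proj₁ (good i)) (proj₁ (good j))
        (adjacent⇒matching T (u i) (u j) (proj₂ (placed j) (toℕ i) i<j))
    M-twist : ∀ i j → i ≢ j → M i j xor M j i ≡ T i j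
    M-twist i j i≢j with <-cmp i j
    ... | tri< i<j _ _ = M-twist< i<j
    ... | tri≈ _ i≡j _ = ⊥-elim (i≢j i≡j)
    ... | tri> _ _ j<i = trans (xor-comm (M i j) (M j i)) (trans (M-twist< j<i) (T-sym j i))

  twisted-no-rainbow : ∀ o → ¬ Rainbow (twisted o) m
  twisted-no-rainbow o (c , rainbow) =
    contradiction (trans (sym (upperParity-edge o)) (evenLabelling⇒upperParity {M = labels} labelling))
                  λ ()
    where
    labels : Part → Label
    labels i = label (c (toℕ i))
    labelling : EvenLabelling (edge zero (suc o)) labels
    labelling = rainbow⇒evenLabelling (edge-sym zero (suc o)) rainbow

module Indistinguishable (k₁ k₂ : ℕ) (o : Fin (k₁ + k₂)) where
  open CFI (k₁ + k₂)
  open _≅_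

  P : Var → Set
  P = AllowedVar k₁ k₂

  unused-part : (a : Var → Vertex) → ∃ λ p → ∀ {x} → P x → part (a x) ≢ p
  unused-part a with p , unhit ← outside-image (λ i → part (a (var k₁ (toℕ i)))) =
    p , λ Px → let i , var≡x = allowed⇒var Px in
               λ part≡p → unhit i (trans (cong (part ∘ a) var≡x) part≡p)

  twist-at : ∀ p → ∃ λ q → p ≢ q × edge p q ≅ edge zero (suc o)
  twist-at zero    = suc o , (λ ()) , ≅-reflexive (λ _ _ → refl)
  twist-at (suc p) = zero , (λ ()) , ≅-trans (≅-reflexive (edge-comm (suc p) zero)) (shift (λ ()) (λ ()))

  record Matched (a : Assignment untwisted) (b : Assignment (twisted o)) : Set where
    field
      p q    : Part
      p≢q    : p ≢ q
      π      : edge p q ≅ edge zero (suc o)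
      b≡πa   : ∀ {x} → P x → b x ≡ to π (a x)
      avoids : ∀ {x} → P x → part (a x) ≢ p

  -- The twist is moved from {p, q} to {p, p'} for a part p' unused by the other variables,
  -- so that it avoids the part of whatever vertex x is placed on next.
  matched-move : ∀ {a b x} → Matched a b → P x →
                 Σ (Vertex ↔ Vertex) λ β →
                   ∀ w → Matched (update {untwisted} a x w) (update {twisted o} b x (Inverse.to β w))
  matched-move {a} {b} {x} matched Px = bijection π' , λ w → relocate w (part w ≟ p)
    where
    open Matched matched
    p' : Part
    p' = proj₁ (unused-part (update {untwisted} a x (vertex p zeros)))
    p'-unused : ∀ {y} → P y → part (update {untwisted} a x (vertex p zeros) y) ≢ p'
    p'-unused = proj₂ (unused-part (update {untwisted} a x (vertex p zeros)))
    p≢p' : p ≢ p'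
    p≢p' = subst (_≢ p') (trans (cong part (update-≡ {untwisted} a x _)) (part-vertex p zeros))
                 (p'-unused Px)
    π' : edge p p' ≅ edge zero (suc o)
    π' = ≅-trans (shift p≢p' p≢q) π
    agrees : ∀ w {y} → P y → update {twisted o} b x (to π' w) y ≡ to π' (update {untwisted} a x w y)
    agrees w {y} Py with y ≟V x
    ... | yes refl = refl
    ... | no y≢x   = trans (b≡πa Py) (cong (to π) (sym (shift-outside p≢p' p≢q (avoids Py))))
    avoiding : ∀ {w r} → part w ≢ r → (∀ {y} → P y → y ≢ x → part (a y) ≢ r) →
               ∀ {y} → P y → part (update {untwisted} a x w y) ≢ r
    avoiding {w} w∉r others {y} Py with y ≟V x
    ... | yes refl = w∉r
    ... | no y≢x   = others Py y≢x
    relocate : ∀ w → Dec (part w ≡ p) →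
               Matched (update {untwisted} a x w) (update {twisted o} b x (to π' w))
    relocate w (yes w∈p) = record
      { p      = p'
      ; q      = p
      ; p≢q    = p≢p' ∘ sym
      ; π      = ≅-trans (≅-reflexive (edge-comm p' p)) π'
      ; b≡πa   = agrees w
      ; avoids = avoiding (λ w∈p' → p≢p' (trans (sym w∈p) w∈p'))
                          λ Py y≢x → subst (λ u → part u ≢ p') (update-≢ {untwisted} a _ y≢x) (p'-unused Py)
      }
    relocate w (no w∉p)  = record
      { p      = p
      ; q      = p'
      ; p≢q    = p≢p'
      ; π      = π'
      ; b≡πa   = agrees w
      ; avoids = avoiding w∉p λ Py _ → avoids Py
      }

  matching : Bisimulation untwisted (twisted o) P
  matching = record
    { _∼_              = Matched
    ; ≡-preserved      = λ {a} {b} {x} {y} matched Px Py → let open Matched matched in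
        mk⇔ (λ ax≡ay → trans (b≡πa Px) (trans (cong (to π) ax≡ay) (sym (b≡πa Py))))
            (λ bx≡by → to-injective π (trans (sym (b≡πa Px)) (trans bx≡by (b≡πa Py))))
    ; adj-preserved    = λ {a} {b} {x} {y} matched Px Py → let open Matched matched in begin
        adjacent noTwist (a x) (a y)
          ≡⟨ adjacent-cong {noTwist} {edge p q} {a x} {a y} (sym (edge-outside q (avoids Px) (avoids Py))) ⟩
        adjacent (edge p q) (a x) (a y)
          ≡⟨ adjacent-to π (a x) (a y) ⟨
        adjacent (edge zero (suc o)) (to π (a x)) (to π (a y))
          ≡⟨ cong₂ (adjacent (edge zero (suc o))) (b≡πa Px) (b≡πa Py) ⟨
        adjacent (edge zero (suc o)) (b x) (b y)
          ∎
    ; colour-preserved = λ {a} {b} {x} matched Px → let open Matched matched in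
        trans (sym (colour-to π (a x))) (cong vertexColour (sym (b≡πa Px)))
    ; move             = matched-move
    ; forth            = λ a → let p , p-free = unused-part a ; q , p≢q , π = twist-at p in
        to π ∘ a , record { p = p ; q = q ; p≢q = p≢q ; π = π ; b≡πa = λ _ → refl ; avoids = p-free }
    ; back             = λ b → let p , p-free = unused-part b ; q , p≢q , π = twist-at p in
        from π ∘ b , record { p = p ; q = q ; p≢q = p≢q ; π = π ; b≡πa = λ _ → sym (to-from π _)
                            ; avoids = λ Px → subst (_≢ p) (sym (part-from π _)) (p-free Px) }
    }
    where open ≡-Reasoning

  C-indistinguishable : ¬ Distinguishes C[ k₁ , k₂ ] untwisted (twisted o)
  C-indistinguishable = indistinguishable matching C[ k₁ , k₂ ] proj₁

singleton : ℕ → ColoredGraph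
singleton c = record
  { n = 1 ; nonempty = s≤s z≤n ; adj = λ _ _ → false ; adj-sym = λ _ _ → refl ; adj-irr = λ _ → refl
  ; colour = λ _ → c }

singleton-rainbow : Rainbow (singleton 0) 0
singleton-rainbow = (λ _ → zero) , λ { .0 z≤n z≤n → refl , λ _ () }

singleton-no-rainbow : ¬ Rainbow (singleton 1) 0
singleton-no-rainbow (c , rainbow) with () ← proj₁ (rainbow 0 z≤n z≤n)

lemma14 : (k₁ k₂ k₁' k₂' : ℕ) → k₁' + k₂' < k₁ + k₂ →
    ¬ (C[ k₁ , k₂ ] ⪯ C[ k₁' , k₂' ])
lemma14 k₁ k₂ k₁' k₂' k'<k C⪯C' =
  Indistinguishable.C-indistinguishable k₁' k₂' o
    (C⪯C' untwisted (twisted o) (rainbow-distinguishes k'<k untwisted-rainbow (twisted-no-rainbow o)))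
  where
  open RainbowClique k₁
  open CFI (k₁' + k₂')
  o : Fin (k₁' + k₂')
  o = distinguishes⇒variable (C⪯C' (singleton 0) (singleton 1)
        (rainbow-distinguishes (≤-trans (s≤s z≤n) k'<k) singleton-rainbow singleton-no-rainbow))
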